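{- Let $I_1$ and $I_2$ be the instances described in the context, where $I_1$ has a feasible solution, and let $O_1$ be an optimal solution of $I_1$. Then the cost of an optimal solution of $I_2$ is at most $2\,Cost_{I_1}(O_1)$.
   Context: Let $I$ be an LBUBFL instance with uniform bounds: finite client set $\mathcal{C}$, finite facility set $\mathcal{F}$, metric $c$ on $\mathcal{C}\cup\mathcal{F}$, opening costs $f_i\ge0$, uniform lower bound $\mathcal{L}$ and upper bound $\mathcal{U}$. Let $S^t=(\mathcal{F}^t,\sigma^t)$ with $\mathcal{F}^t\subseteq\mathcal{F}$, $\sigma^t:\mathcal{C}\to\mathcal{F}^t$ satisfy $\alpha\mathcal{L}\le|(\sigma^t)^{ -1}(i)|\le\beta\mathcal{U}$ for all $i\in\mathcal{F}^t$, where $1/2<\alpha\le1$, $\beta=3/2$. Instance $I_1$: an LBUBFL instance with facility set $\mathcal{F}$, bounds $\mathcal{L},\mathcal{U}$, client set $\mathcal{C}$ where serving $j$ from $i$ costs $c(\sigma^t(j),i)$ (client $j$ located at $\sigma^t(j)$), and opening costs $f^1_i=0$ for $i\in\mathcal{F}^t$, $f^1_i=f_i$ otherwise; a feasible solution is $(\mathcal{F}',\sigma)$, $\mathcal{F}'\subseteq\mathcal{F}$, $\sigma:\mathcal{C}\to\mathcal{F}'$ with $\mathcal{L}\le|\sigma^{ -1}(i)|\le\mathcal{U}$ for $i\in\mathcal{F}'$, of cost $Cost_{I_1}=\sum_{i\in\mathcal{F}'}f^1_i+\sum_j c(\sigma^t(j),\sigma(j))$. Instance $I_2$ (lower-bounded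 facility location, no upper bounds): facility set $\mathcal{F}^t$, all opening costs $0$, same clients located at $\sigma^t(j)$; a feasible solution is $(\mathcal{F}'',\sigma)$, $\mathcal{F}''\subseteq\mathcal{F}^t$, $\sigma:\mathcal{C}\to\mathcal{F}''$, with $|\sigma^{ -1}(i)|\ge\mathcal{L}$ for all $i\in\mathcal{F}''$, of cost $\sum_j c(\sigma^t(j),\sigma(j))$.
   Formalization: The metric c and the opening costs $f_i$ take rational values, and the parameter α is rational. -}

module Defs where

open import Data.Nat as ℕ using (ℕ; zero; suc)
open import Data.Fin using (Fin; zero; suc)
open import Data.Fin.Properties using () renaming (_≟_ to _≟ᶠ_)
open import Data.Fin.Subset using (Subset; _∈_)
open import Data.Fin.Subset.Properties using (_∈?_)
open import Data.Sum using (_⊎_; inj₁; inj₂)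
open import Data.Integer using (+_)
open import Data.Rational using (ℚ; 0ℚ; 1ℚ; ½; _+_; _*_; _≤_; _<_; _/_)
open import Relation.Binary.PropositionalEquality using (_≡_)
open import Relation.Nullary using (yes; no)
open import Data.Product using (_×_)

ℕ→ℚ : ℕ → ℚ
ℕ→ℚ n = + n / 1

sumFin : ∀ {n} → (Fin n → ℚ) → ℚ
sumFin {zero}  g = 0ℚ
sumFin {suc n} g = g zero + sumFin (λ i → g (suc i))

load : ∀ {nc nf} → (Fin nc → Fin nf) → Fin nf → ℕ
load {zero}  σ i = zero
load {suc n} σ i with σ zero ≟ᶠ i
... | yes _ = suc (load (λ j → σ (suc j)) i)
... | no  _ = load (λ j → σ (suc j)) i

β : ℚ
β = + 3 / 2

-- points of C ∪ F : clients are inj₁, facilities are inj₂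
Point : ℕ → ℕ → Set
Point nc nf = Fin nc ⊎ Fin nf

record IsMetric {A : Set} (c : A → A → ℚ) : Set where
  field
    nonneg  : ∀ x y → 0ℚ ≤ c x y
    zero-eq : ∀ x → c x x ≡ 0ℚ
    eq-zero : ∀ x y → c x y ≡ 0ℚ → x ≡ y
    sym     : ∀ x y → c x y ≡ c y x
    triangle : ∀ x y z → c x z ≤ c x y + c y z

sumOver : ∀ {n} → Subset n → (Fin n → ℚ) → ℚ
sumOver S g = sumFin (λ i → sum1 i (i ∈? S))
  where
  open import Relation.Nullary using (Dec)
  sum1 : ∀ i → Dec (i ∈ S) → ℚ
  sum1 i (yes _) = g i
  sum1 i (no _)  = 0ℚ

f¹ : ∀ {nf} → Subset nf → (Fin nf → ℚ) → Fin nf → ℚ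
f¹ Ft f i with i ∈? Ft
... | yes _ = 0ℚ
... | no  _ = f i

FeasibleI₁ : ∀ {nc nf} → (L U : ℕ) → Subset nf → (Fin nc → Fin nf) → Set
FeasibleI₁ L U F' σ =
  (∀ j → σ j ∈ F') × (∀ i → i ∈ F' → (L ℕ.≤ load σ i) × (load σ i ℕ.≤ U))

CostI₁ : ∀ {nc nf} → (c : Point nc nf → Point nc nf → ℚ) → (f : Fin nf → ℚ)
       → (Ft : Subset nf) → (σt : Fin nc → Fin nf)
       → Subset nf → (Fin nc → Fin nf) → ℚ
CostI₁ c f Ft σt F' σ =
  sumOver F' (f¹ Ft f) + sumFin (λ j → c (inj₂ (σt j)) (inj₂ (σ j)))

FeasibleI₂ : ∀ {nc nf} → (L : ℕ) → (Ft : Subset nf) → Subset nf → (Fin nc → Fin nf) → Set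
FeasibleI₂ L Ft F'' σ =
  (∀ i → i ∈ F'' → i ∈ Ft) × (∀ j → σ j ∈ F'') × (∀ i → i ∈ F'' → L ℕ.≤ load σ i)

CostI₂ : ∀ {nc nf} → (c : Point nc nf → Point nc nf → ℚ)
       → (σt : Fin nc → Fin nf) → (Fin nc → Fin nf) → ℚ
CostI₂ c σt σ = sumFin (λ j → c (inj₂ (σt j)) (inj₂ (σ j)))

-- Move every facility opened by O₁ to the closest facility used by σᵗ (these
-- lie in Fᵗ). A client j then travels from σᵗ j via σ₁ j to a facility no
-- farther from σ₁ j than σᵗ j is, so by the triangle inequality its cost at most
-- doubles. Merging facilities only increases loads, so the lower bound L
-- survives, and the nonnegative opening costs of O₁ are simply dropped.
module Submission where

open import Defs
open import Data.Nat using (ℕ)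
open import Data.Fin using (Fin)
open import Data.Fin.Subset using (Subset; _∈_)
open import Data.Product using (_×_; ∃₂)
open import Data.Integer using (+_)
open import Data.Rational using (ℚ; 0ℚ; 1ℚ; ½; _*_; _≤_; _<_; _/_)

open import Data.Nat as ℕ using (zero; suc)
import Data.Nat.Properties as ℕ
open import Data.Fin using (zero; suc)
open import Data.Fin.Properties using () renaming (_≟_ to _≟ᶠ_)
open import Data.Fin.Subset using (⊥; ⁅_⁆; _∪_)
open import Data.Fin.Subset.Properties using (_∈?_; ∉⊥; x∈⁅x⁆; x∈⁅y⁆⇒x≡y; x∈p∪q⁻; x∈p∪q⁺)
open import Data.List using (allFin)
open import Data.List.Membership.Propositional.Properties using (∈-allFin)
import Data.List.Relation.Unary.All as All
open import Data.Rational using (_+_)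
open import Data.Rational.Properties
  using (≤-refl; ≤-trans; +-mono-≤; +-monoʳ-≤; +-monoˡ-≤; +-identityˡ;
         *-zeroʳ; *-identityˡ; *-distribˡ-+; *-distribʳ-+; *-monoˡ-≤-nonNeg; ≤-decTotalOrder; module ≤-Reasoning)
open import Data.Product using (_,_; proj₁)
open import Data.Sum using (inj₁; inj₂)
open import Function using (_∘_)
open import Relation.Binary.Bundles using (DecTotalOrder)
open import Relation.Nullary using (yes; no; contradiction)
open import Relation.Binary.PropositionalEquality using (_≡_; refl; sym; cong; cong₂; subst; module ≡-Reasoning)

open import Data.List.Extrema (DecTotalOrder.totalOrder ≤-decTotalOrder) using (argmin; f[argmin]≤f[xs])

sumFin-mono : ∀ {n} {a b : Fin n → ℚ} → (∀ i → a i ≤ b i) → sumFin a ≤ sumFin b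
sumFin-mono {zero}  a≤b = ≤-refl
sumFin-mono {suc n} a≤b = +-mono-≤ (a≤b zero) (sumFin-mono (a≤b ∘ suc))

sumFin-nonNeg : ∀ {n} {a : Fin n → ℚ} → (∀ i → 0ℚ ≤ a i) → 0ℚ ≤ sumFin a
sumFin-nonNeg {zero}  a≥0 = ≤-refl
sumFin-nonNeg {suc n} a≥0 = +-mono-≤ (a≥0 zero) (sumFin-nonNeg (a≥0 ∘ suc))

sumFin-*ˡ : ∀ {n} q (a : Fin n → ℚ) → sumFin (λ i → q * a i) ≡ q * sumFin a
sumFin-*ˡ {zero}  q a = sym (*-zeroʳ q)
sumFin-*ˡ {suc n} q a = begin
  q * a zero + sumFin (λ i → q * a (suc i)) ≡⟨ cong (λ s → q * a zero + s) (sumFin-*ˡ q (a ∘ suc)) ⟩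
  q * a zero + q * sumFin (a ∘ suc)         ≡⟨ sym (*-distribˡ-+ q (a zero) _) ⟩
  q * sumFin a                              ∎
  where open ≡-Reasoning

-- The summand of sumOver is local to Defs and cannot be named; summandOf
-- recovers it from the equation sumOver S g ≡ sumFin a by unification.
summandOf : ∀ {n} (a : Fin n → ℚ) {q : ℚ} → q ≡ sumFin a → Fin n → ℚ
summandOf a _ = a

sumOver-summand-nonNeg : ∀ {n} (S : Subset n) {g : Fin n → ℚ} → (∀ i → 0ℚ ≤ g i)
                       → ∀ i → 0ℚ ≤ summandOf _ (refl {x = sumOver S g}) i
sumOver-summand-nonNeg S g≥0 i with i ∈? S
... | yes _ = g≥0 i
... | no  _ = ≤-refl

sumOver-nonNeg : ∀ {n} (S : Subset n) {g : Fin n → ℚ} → (∀ i → 0ℚ ≤ g i) → 0ℚ ≤ sumOver S g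
sumOver-nonNeg S g≥0 = sumFin-nonNeg (sumOver-summand-nonNeg S g≥0)

f¹-nonNeg : ∀ {nf} (Ft : Subset nf) {f : Fin nf → ℚ} → (∀ i → 0ℚ ≤ f i) → ∀ i → 0ℚ ≤ f¹ Ft f i
f¹-nonNeg Ft f≥0 i with i ∈? Ft
... | yes _ = ≤-refl
... | no  _ = f≥0 i

CostI₂≤CostI₁ : ∀ {nc nf} (c : Point nc nf → Point nc nf → ℚ) {f : Fin nf → ℚ} → (∀ i → 0ℚ ≤ f i)
              → (Ft : Subset nf) (σt : Fin nc → Fin nf) (F : Subset nf) (σ : Fin nc → Fin nf)
              → CostI₂ c σt σ ≤ CostI₁ c f Ft σt F σ
CostI₂≤CostI₁ c f≥0 Ft σt F σ = begin
  CostI₂ c σt σ                             ≡⟨ sym (+-identityˡ _) ⟩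
  0ℚ + CostI₂ c σt σ                        ≤⟨ +-monoˡ-≤ _ (sumOver-nonNeg F (f¹-nonNeg Ft f≥0)) ⟩
  CostI₁ c _ Ft σt F σ                      ∎
  where open ≤-Reasoning

module _ {A : Set} (d : A → A → ℚ) where

  -- Junk value x when there are no candidates.
  closest : ∀ {m} → (Fin m → A) → A → A
  closest {zero}  p x = x
  closest {suc m} p x = p (argmin (d x ∘ p) zero (allFin (suc m)))

  closest-≤ : ∀ {m} (p : Fin m → A) x k → d x (closest p x) ≤ d x (p k)
  closest-≤ {suc m} p x k = All.lookup (f[argmin]≤f[xs] {f = d x ∘ p} zero (allFin (suc m))) (∈-allFin k)

  closest-preserves : ∀ {m} {P : A → Set} (p : Fin m → A) → (∀ k → P (p k)) → Fin m → ∀ x → P (closest p x)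
  closest-preserves {suc m} p Pp _ x = Pp _

image : ∀ {nc nf} → (Fin nc → Fin nf) → Subset nf
image {zero}  σ = ⊥
image {suc n} σ = ⁅ σ zero ⁆ ∪ image (σ ∘ suc)

∈-image : ∀ {nc nf} (σ : Fin nc → Fin nf) j → σ j ∈ image σ
∈-image {suc n} σ zero    = x∈p∪q⁺ (inj₁ (x∈⁅x⁆ (σ zero)))
∈-image {suc n} σ (suc j) = x∈p∪q⁺ {p = ⁅ σ zero ⁆} (inj₂ (∈-image (σ ∘ suc) j))

image-⊆ : ∀ {nc nf} {P : Fin nf → Set} (σ : Fin nc → Fin nf) → (∀ j → P (σ j)) → ∀ i → i ∈ image σ → P i
image-⊆ {zero}  σ Pσ i i∈ = contradiction i∈ ∉⊥
image-⊆ {suc n} {P = P} σ Pσ i i∈ with x∈p∪q⁻ ⁅ σ zero ⁆ (image (σ ∘ suc)) i∈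
... | inj₁ i∈⁅σ0⁆ = subst P (sym (x∈⁅y⁆⇒x≡y (σ zero) i∈⁅σ0⁆)) (Pσ zero)
... | inj₂ i∈rest = image-⊆ (σ ∘ suc) (Pσ ∘ suc) i i∈rest

load-∘ : ∀ {nc nf} (σ : Fin nc → Fin nf) (h : Fin nf → Fin nf) x → load σ x ℕ.≤ load (h ∘ σ) (h x)
load-∘ {zero}  σ h x = ℕ.z≤n
load-∘ {suc n} σ h x with σ zero ≟ᶠ x | h (σ zero) ≟ᶠ h x
... | yes _    | yes _    = ℕ.s≤s (load-∘ (σ ∘ suc) h x)
... | yes σ0≡x | no  h≢   = contradiction (cong h σ0≡x) h≢
... | no  _    | yes _    = ℕ.m≤n⇒m≤1+n (load-∘ (σ ∘ suc) h x)
... | no  _    | no  _    = load-∘ (σ ∘ suc) h x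

2*q≡q+q : ∀ q → (+ 2 / 1) * q ≡ q + q
2*q≡q+q q = begin
  (1ℚ + 1ℚ) * q   ≡⟨ *-distribʳ-+ q 1ℚ 1ℚ ⟩
  1ℚ * q + 1ℚ * q ≡⟨ cong₂ _+_ (*-identityˡ q) (*-identityˡ q) ⟩
  q + q           ∎
  where open ≡-Reasoning

module _ {A : Set} {c : A → A → ℚ} (metric : IsMetric c) where
  open IsMetric metric using (triangle) renaming (sym to c-sym)

  closer-to-y⇒c[x,z]≤2*c[x,y] : ∀ x y z → c y z ≤ c y x → c x z ≤ (+ 2 / 1) * c x y
  closer-to-y⇒c[x,z]≤2*c[x,y] x y z yz≤yx = begin
    c x z           ≤⟨ triangle x y z ⟩
    c x y + c y z   ≤⟨ +-monoʳ-≤ (c x y) yz≤yx ⟩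
    c x y + c y x   ≡⟨ cong (λ r → c x y + r) (c-sym y x) ⟩
    c x y + c x y   ≡⟨ sym (2*q≡q+q (c x y)) ⟩
    (+ 2 / 1) * c x y ∎
    where open ≤-Reasoning

CostI₂-≤-2* : ∀ {nc nf} {c : Point nc nf → Point nc nf → ℚ} → IsMetric c
            → (σt σ σ' : Fin nc → Fin nf)
            → (∀ j → c (inj₂ (σ j)) (inj₂ (σ' j)) ≤ c (inj₂ (σ j)) (inj₂ (σt j)))
            → CostI₂ c σt σ' ≤ (+ 2 / 1) * CostI₂ c σt σ
CostI₂-≤-2* {c = c} metric σt σ σ' σ'-closer = begin
  CostI₂ c σt σ'                  ≤⟨ sumFin-mono per-client ⟩
  sumFin (λ j → (+ 2 / 1) * a j)  ≡⟨ sumFin-*ˡ (+ 2 / 1) a ⟩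
  (+ 2 / 1) * CostI₂ c σt σ       ∎
  where
  open ≤-Reasoning
  a : Fin _ → ℚ
  a j = c (inj₂ (σt j)) (inj₂ (σ j))
  per-client : ∀ j → c (inj₂ (σt j)) (inj₂ (σ' j)) ≤ (+ 2 / 1) * a j
  per-client j = closer-to-y⇒c[x,z]≤2*c[x,y] metric (inj₂ (σt j)) (inj₂ (σ j)) (inj₂ (σ' j)) (σ'-closer j)

lemma3p2 : (nc nf : ℕ)
    → (c : Point nc nf → Point nc nf → ℚ) → IsMetric c
    → (f : Fin nf → ℚ) → (∀ i → 0ℚ ≤ f i)
    → (L U : ℕ)
    → (α : ℚ) → ½ < α → α ≤ 1ℚ
    → (Ft : Subset nf) → (σt : Fin nc → Fin nf)
    → (∀ j → σt j ∈ Ft)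
    → (∀ i → i ∈ Ft → (α * ℕ→ℚ L ≤ ℕ→ℚ (load σt i)) × (ℕ→ℚ (load σt i) ≤ β * ℕ→ℚ U))
    → (F₁ : Subset nf) → (σ₁ : Fin nc → Fin nf)
    → FeasibleI₁ L U F₁ σ₁
    → (∀ (F' : Subset nf) (σ : Fin nc → Fin nf) → FeasibleI₁ L U F' σ
         → CostI₁ c f Ft σt F₁ σ₁ ≤ CostI₁ c f Ft σt F' σ)
    → ∃₂ λ (F'' : Subset nf) (σ₂ : Fin nc → Fin nf)
         → FeasibleI₂ L Ft F'' σ₂
         × (CostI₂ c σt σ₂ ≤ (+ 2 / 1) * CostI₁ c f Ft σt F₁ σ₁)
lemma3p2 nc nf c metric f f≥0 L U _ _ _ Ft σt σt∈Ft _ F₁ σ₁ (σ₁∈F₁ , F₁-bounds) _ =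
  image σ₂ , σ₂ , feasible , cost
  where
  d : Fin nf → Fin nf → ℚ
  d x y = c (inj₂ x) (inj₂ y)

  snap : Fin nf → Fin nf
  snap = closest d σt

  σ₂ : Fin nc → Fin nf
  σ₂ = snap ∘ σ₁

  σ₂∈Ft : ∀ j → σ₂ j ∈ Ft
  σ₂∈Ft j = closest-preserves d {P = _∈ Ft} σt σt∈Ft j (σ₁ j)

  L≤load[σ₂] : ∀ j → L ℕ.≤ load σ₂ (σ₂ j)
  L≤load[σ₂] j = ℕ.≤-trans (proj₁ (F₁-bounds (σ₁ j) (σ₁∈F₁ j))) (load-∘ σ₁ snap (σ₁ j))

  feasible : FeasibleI₂ L Ft (image σ₂) σ₂
  feasible = image-⊆ {P = _∈ Ft} σ₂ σ₂∈Ft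
           , ∈-image σ₂
           , image-⊆ {P = λ i → L ℕ.≤ load σ₂ i} σ₂ L≤load[σ₂]

  cost : CostI₂ c σt σ₂ ≤ (+ 2 / 1) * CostI₁ c f Ft σt F₁ σ₁
  cost = ≤-trans (CostI₂-≤-2* metric σt σ₁ σ₂ (λ j → closest-≤ d σt (σ₁ j) j))
                 (*-monoˡ-≤-nonNeg (+ 2 / 1) (CostI₂≤CostI₁ c f≥0 Ft σt F₁ σ₁))
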